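{- There exist a finitary matroid $M$ and a co-finitary matroid $N$ such that $\mathcal{I}(M\vee N)$ is not the set of independent sets of a matroid.
   Context: Matroids may be infinite: a matroid on $E$ is a pair $(E,\mathcal{I})$ with $\mathcal{I}\subseteq\mathcal{P}(E)$ satisfying (I1) $\emptyset\in\mathcal{I}$; (I2) closure under subsets; (I3) whenever $I,I'\in\mathcal{I}$ with $I'$ maximal and $I$ not maximal, there is $x\in I'\setminus I$ with $I+x\in\mathcal{I}$; (IM) whenever $I\subseteq X\subseteq E$ and $I\in\mathcal{I}$, the set $\{I'\in\mathcal{I}: I\subseteq I'\subseteq X\}$ has a maximal element. The dual $M^*$ has as bases the complements of the bases of $M$. $M$ is finitary if every set all of whose finite subsets are independent is independent; co-finitary if $M^*$ is finitary. $\mathcal{I}(M\vee N)=\{I_1\cup I_2: I_1\in\mathcal{I}(M), I_2\in\mathcal{I}(N)\}$. -}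

module Defs where

open import Level using (0ℓ)
open import Data.Product using (Σ; ∃; ∃-syntax; _×_; _,_)
open import Data.List using (List)
open import Data.List.Membership.Propositional using () renaming (_∈_ to _∈ˡ_)
open import Relation.Nullary using (¬_)
import Data.Empty
open import Relation.Unary using (Pred; _⊆_; _∪_; _∖_; ∁; ｛_｝; _∈_; _≐_)
open import Function.Bundles using (_⇔_)

Subset : Set → Set₁
Subset E = Pred E 0ℓ

Family : Set → Set₂
Family E = Subset E → Set₁

module _ {E : Set} (𝓘 : Family E) where

  Maximal : Subset E → Set₁
  Maximal I = 𝓘 I × (∀ J → 𝓘 J → I ⊆ J → J ⊆ I)

  MaximalBetween : Subset E → Subset E → Subset E → Set₁
  MaximalBetween I X J =
    (𝓘 J × I ⊆ J × J ⊆ X) ×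
    (∀ K → 𝓘 K → I ⊆ K → K ⊆ X → J ⊆ K → K ⊆ J)

  record IsMatroid : Set₁ where
    field
      I1 : 𝓘 (λ _ → Data.Empty.⊥)
      I2 : ∀ I J → 𝓘 J → I ⊆ J → 𝓘 I
      I3 : ∀ I I' → 𝓘 I → Maximal I' → ¬ Maximal I →
           ∃[ x ] (x ∈ I' × ¬ (x ∈ I) × 𝓘 (I ∪ ｛ x ｝))
      IM : ∀ I X → 𝓘 I → I ⊆ X → ∃[ J ] MaximalBetween I X J

record Matroid (E : Set) : Set₂ where
  field
    indep     : Family E
    isMatroid : IsMatroid indep
open Matroid public

Base : {E : Set} → Matroid E → Subset E → Set₁
Base M B = Maximal (indep M) B

dualIndep : {E : Set} → Matroid E → Family E
dualIndep M I = ∃[ B ] (Base M B × I ⊆ ∁ B)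

Finite : {E : Set} → Subset E → Set
Finite {E} F = ∃[ xs ] (∀ (x : E) → (F x ⇔ x ∈ˡ xs))

FinitaryFamily : {E : Set} → Family E → Set₁
FinitaryFamily {E} 𝓘 = ∀ (I : Subset E) → (∀ F → Finite F → F ⊆ I → 𝓘 F) → 𝓘 I

Finitary : {E : Set} → Matroid E → Set₁
Finitary M = FinitaryFamily (indep M)

CoFinitary : {E : Set} → Matroid E → Set₁
CoFinitary M = FinitaryFamily (dualIndep M)

unionIndep : {E : Set} → Matroid E → Matroid E → Family E
unionIndep M N I = ∃[ I₁ ] ∃[ I₂ ] (indep M I₁ × indep N I₂ × I ≐ (I₁ ∪ I₂))

-- The ground set is a grid of cells c k j (row k, column j) together with one
-- extra point d j in each column j.  M is the partition matroid allowing at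
-- most one point per column (finitary); N declares the points d j to be loops
-- and a set of cells independent when it misses at least one cell in every row,
-- so N* allows at most one cell per row (N is co-finitary).  The set of all
-- cells is (M ∨ N)-independent, say with the diagonal in M.  Now take any
-- decomposition I₁ ∪ I₂ of an independent J containing all cells: the cell
-- c k (h k) that I₂ misses in row k lies in I₁, so h is injective and no
-- d (h k) is in J.  Yet J + d (h 0) is independent again: shift the cells of
-- the M-part to c k (h (k + 1)), which frees column h 0.  Hence (IM) fails for
-- the cells inside the whole ground set.
module Submission where

open import Defs
open import Level using (Level; 0ℓ)
open import Data.Product using (Σ; ∃-syntax; _×_; _,_; proj₁; proj₂)
open import Data.Sum using (_⊎_; inj₁; inj₂)
open import Data.Empty using (⊥; ⊥-elim)
open import Data.Unit using (⊤; tt)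
open import Data.Nat using (ℕ; suc; _≤_; _<_; _≟_)
open import Data.Nat.Properties using (≤-antisym; ≮⇒≥; suc-injective; 0≢1+n)
open import Data.Nat.Induction using (<-wellFounded)
open import Induction.WellFounded using (Acc; acc)
open import Data.List using ([]; _∷_)
open import Data.List.Relation.Unary.Any using (here; there)
open import Data.List.Membership.Propositional using () renaming (_∈_ to _∈ˡ_)
open import Function using (_∘_)
open import Function.Bundles using (mk⇔)
open import Relation.Nullary using (¬_; yes; no)
open import Relation.Nullary.Decidable using (decidable-stable)
open import Axiom.ExcludedMiddle using (ExcludedMiddle)
open import Axiom.DoubleNegationElimination using (em⇒dne)
open import Relation.Binary.PropositionalEquality
  using (_≡_; _≢_; refl; sym; trans; cong; cong₂; subst)
open import Relation.Unary using (_⊆_; _∪_; ｛_｝; ∁; _≐_; _∈_; ∅; U)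

pair-finite : ∀ {E : Set} (x y : E) → Finite (｛ x ｝ ∪ ｛ y ｝)
pair-finite x y = x ∷ y ∷ [] , λ z → mk⇔ to from
  where
  to : ∀ {z} → (｛ x ｝ ∪ ｛ y ｝) z → z ∈ˡ x ∷ y ∷ []
  to (inj₁ refl) = here refl
  to (inj₂ refl) = there (here refl)
  from : ∀ {z} → z ∈ˡ x ∷ y ∷ [] → (｛ x ｝ ∪ ｛ y ｝) z
  from (here refl) = inj₁ refl
  from (there (here refl)) = inj₂ refl
  from (there (there ()))

pair-⊆ : ∀ {E : Set} {I : Subset E} {x y} → I x → I y → ｛ x ｝ ∪ ｛ y ｝ ⊆ I
pair-⊆ Ix Iy (inj₁ refl) = Ix
pair-⊆ Ix Iy (inj₂ refl) = Iy

least-witness : ExcludedMiddle 0ℓ → (P : ℕ → Set) → ∀ {n} → P n →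
                ∃[ m ] (P m × (∀ k → P k → m ≤ k))
least-witness em P {n} = go n (<-wellFounded n)
  where
  go : ∀ n → Acc _<_ n → P n → ∃[ m ] (P m × (∀ k → P k → m ≤ k))
  go n (acc smaller) Pn with em {∃[ k ] (k < n × P k)}
  ... | yes (k , k<n , Pk) = go k (smaller k<n) Pk
  ... | no nothing-smaller = n , Pn , λ k Pk → ≮⇒≥ (λ k<n → nothing-smaller (k , k<n , Pk))

-- Classically, (I3) only needs: if nothing in I' ∖ I augments I, then I is maximal.
augmentation-from-saturation :
  (∀ {ℓ} → ExcludedMiddle ℓ) → ∀ {E : Set} {𝓘 : Family E} {I I' : Subset E} → 𝓘 I →
  (¬ (∃[ x ] (x ∈ I' × ¬ (x ∈ I) × 𝓘 (I ∪ ｛ x ｝))) →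
    ∀ J {y} → 𝓘 J → I ⊆ J → J y → ¬ ¬ I y) →
  ¬ Maximal 𝓘 I → ∃[ x ] (x ∈ I' × ¬ (x ∈ I) × 𝓘 (I ∪ ｛ x ｝))
augmentation-from-saturation em iI saturated ¬maximal with em
... | yes augmenting = augmenting
... | no ¬augmenting = ⊥-elim (¬maximal (iI , λ J iJ I⊆J Jy →
  em⇒dne em (saturated ¬augmenting J iJ I⊆J Jy)))

module PartitionMatroid {E B : Set} (block : E → B) (position : E → ℕ)
  (block-position-injective : ∀ x y → block x ≡ block y → position x ≡ position y → x ≡ y)
  where

  record OnePerBlock (I : Subset E) : Set₁ where
    constructor onePerBlock
    field unique : ∀ x y → I x → I y → block x ≡ block y → x ≡ y
  open OnePerBlock public

  BlockFree : Subset E → B → Set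
  BlockFree I b = ¬ (∃[ z ] (I z × block z ≡ b))

  onePerBlock-∅ : OnePerBlock ∅
  onePerBlock-∅ = onePerBlock λ _ _ ()

  onePerBlock-⊆ : ∀ I J → OnePerBlock J → I ⊆ J → OnePerBlock I
  onePerBlock-⊆ I J iJ I⊆J = onePerBlock λ x y Ix Iy → unique iJ x y (I⊆J Ix) (I⊆J Iy)

  onePerBlock-∪ : ∀ {I} x → OnePerBlock I → BlockFree I (block x) → OnePerBlock (I ∪ ｛ x ｝)
  onePerBlock-∪ {I} x iI free = onePerBlock u
    where
    u : ∀ y z → (I ∪ ｛ x ｝) y → (I ∪ ｛ x ｝) z → block y ≡ block z → y ≡ z
    u y z (inj₁ Iy) (inj₁ Iz) e = unique iI y z Iy Iz e
    u y z (inj₁ Iy) (inj₂ refl) e = ⊥-elim (free (y , Iy , e))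
    u y z (inj₂ refl) (inj₁ Iz) e = ⊥-elim (free (z , Iz , sym e))
    u y z (inj₂ refl) (inj₂ refl) e = refl

  onePerBlock-finitary : FinitaryFamily OnePerBlock
  onePerBlock-finitary I finite-parts = onePerBlock λ x y Ix Iy →
    unique (finite-parts _ (pair-finite x y) (pair-⊆ {I = I} Ix Iy)) x y (inj₁ refl) (inj₂ refl)

  blockFree-below : ∀ {I J y} → OnePerBlock J → I ⊆ J → J y → ¬ I y → BlockFree I (block y)
  blockFree-below {I} iJ I⊆J Jy ¬Iy (z , Iz , e) = ¬Iy (subst I (unique iJ _ _ (I⊆J Iz) Jy e) Iz)

  -- (IM) must pick a point of X in each block free of I; taking the one of
  -- least position avoids the axiom of choice.
  lowestCompletion : Subset E → Subset E → Subset E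
  lowestCompletion I X x =
    X x × (I x ⊎ (BlockFree I (block x) ×
                  (∀ z → X z → block z ≡ block x → position x ≤ position z)))

  onePerBlock-lowestCompletion : ∀ {I X} → OnePerBlock I → OnePerBlock (lowestCompletion I X)
  onePerBlock-lowestCompletion {I} {X} iI = onePerBlock u
    where
    u : ∀ x y → lowestCompletion I X x → lowestCompletion I X y → block x ≡ block y → x ≡ y
    u x y (_ , inj₁ Ix) (_ , inj₁ Iy) e = unique iI x y Ix Iy e
    u x y (_ , inj₁ Ix) (_ , inj₂ (free , _)) e = ⊥-elim (free (x , Ix , e))
    u x y (_ , inj₂ (free , _)) (_ , inj₁ Iy) e = ⊥-elim (free (y , Iy , sym e))
    u x y (Xx , inj₂ (_ , lowest-x)) (Xy , inj₂ (_ , lowest-y)) e =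
      block-position-injective x y e (≤-antisym (lowest-x y Xy (sym e)) (lowest-y x Xx e))

  module _ (em : ∀ {ℓ} → ExcludedMiddle ℓ) where

    lowestCompletion-maximal : ∀ {I X} K → OnePerBlock K → I ⊆ K → K ⊆ X →
                               lowestCompletion I X ⊆ K → K ⊆ lowestCompletion I X
    lowestCompletion-maximal {I} {X} K iK I⊆K K⊆X J⊆K {y} Ky with em {P = I y}
    ... | yes Iy = K⊆X Ky , inj₁ Iy
    ... | no ¬Iy with least-witness em (λ n → ∃[ z ] (X z × block z ≡ block y × position z ≡ n))
                                       (y , K⊆X Ky , refl , refl)
    ... | _ , (z , Xz , same-block , refl) , least =
      subst (lowestCompletion I X) (unique iK z y (J⊆K Jz) Ky same-block) Jz
      where
      free : BlockFree I (block y)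
      free = blockFree-below iK I⊆K Ky ¬Iy
      Jz : lowestCompletion I X z
      Jz = Xz , inj₂ ((λ (w , Iw , e) → free (w , Iw , trans e same-block)) ,
                      λ z' Xz' e → least (position z') (z' , Xz' , trans e same-block , refl))

    onePerBlock-IM : ∀ I X → OnePerBlock I → I ⊆ X → ∃[ J ] MaximalBetween OnePerBlock I X J
    onePerBlock-IM I X iI I⊆X =
      lowestCompletion I X ,
      (onePerBlock-lowestCompletion iI , (λ Ix → I⊆X Ix , inj₁ Ix) , proj₁) ,
      lowestCompletion-maximal

    onePerBlock-I3 : ∀ I I' → OnePerBlock I → Maximal OnePerBlock I' → ¬ Maximal OnePerBlock I →
                     ∃[ x ] (x ∈ I' × ¬ (x ∈ I) × OnePerBlock (I ∪ ｛ x ｝))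
    onePerBlock-I3 I I' iI (iI' , maximal-I') = augmentation-from-saturation em iI saturated
      where
      saturated : ¬ (∃[ x ] (x ∈ I' × ¬ (x ∈ I) × OnePerBlock (I ∪ ｛ x ｝))) →
                  ∀ J {y} → OnePerBlock J → I ⊆ J → J y → ¬ ¬ I y
      saturated ¬augmenting J {y} iJ I⊆J Jy ¬Iy = I'-free (y , I'y , refl)
        where
        I-free : BlockFree I (block y)
        I-free = blockFree-below iJ I⊆J Jy ¬Iy
        I'-free : BlockFree I' (block y)
        I'-free (x , I'x , e) =
          ¬augmenting (x , I'x , (λ Ix → I-free (x , Ix , e)) ,
                       onePerBlock-∪ x iI (λ (z , Iz , e') → I-free (z , Iz , trans e' e)))
        I'y : I' y
        I'y = maximal-I' (I' ∪ ｛ y ｝) (onePerBlock-∪ y iI' I'-free) inj₁ (inj₂ refl)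

    partitionMatroid : Matroid E
    partitionMatroid = record
      { indep = OnePerBlock
      ; isMatroid = record
        { I1 = onePerBlock-∅ ; I2 = onePerBlock-⊆ ; I3 = onePerBlock-I3 ; IM = onePerBlock-IM } }

data E : Set where
  c : ℕ → ℕ → E
  d : ℕ → E

column : E → ℕ
column (c k j) = j
column (d j) = j

height : E → ℕ
height (c k j) = suc k
height (d j) = 0

column-height-injective : ∀ x y → column x ≡ column y → height x ≡ height y → x ≡ y
column-height-injective (c k j) (c .k .j) refl refl = refl
column-height-injective (d j) (d .j) refl refl = refl

open PartitionMatroid column height column-height-injective

record MissesEveryRow (I : Subset E) : Set₁ where
  constructor missesEveryRow
  field
    avoids-d : ∀ j → ¬ I (d j)
    misses   : ∀ k → ∃[ j ] ¬ I (c k j)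
open MissesEveryRow

missesEveryRow-∅ : MissesEveryRow ∅
missesEveryRow-∅ = missesEveryRow (λ _ ()) (λ _ → 0 , λ ())

missesEveryRow-⊆ : ∀ I J → MissesEveryRow J → I ⊆ J → MissesEveryRow I
missesEveryRow-⊆ I J iJ I⊆J = missesEveryRow
  (λ j → avoids-d iJ j ∘ I⊆J)
  (λ k → proj₁ (misses iJ k) , proj₂ (misses iJ k) ∘ I⊆J)

missesEveryRow-∪ : ∀ {I} k j j₀ → MissesEveryRow I → ¬ I (c k j₀) → j₀ ≢ j →
                   MissesEveryRow (I ∪ ｛ c k j ｝)
missesEveryRow-∪ {I} k j j₀ iI ¬Ij₀ j₀≢j = missesEveryRow avoids-d' misses'
  where
  avoids-d' : ∀ i → ¬ (I ∪ ｛ c k j ｝) (d i)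
  avoids-d' i (inj₁ Id) = avoids-d iI i Id
  avoids-d' i (inj₂ ())
  misses' : ∀ k' → ∃[ i ] ¬ (I ∪ ｛ c k j ｝) (c k' i)
  misses' k' with k ≟ k'
  ... | yes refl = j₀ , λ { (inj₁ Ij₀) → ¬Ij₀ Ij₀ ; (inj₂ refl) → j₀≢j refl }
  ... | no k≢k' = proj₁ (misses iI k') ,
                  λ { (inj₁ Ik') → proj₂ (misses iI k') Ik' ; (inj₂ refl) → k≢k' refl }

maximal-contains-row : ∀ {I' k j j₀} → Maximal MissesEveryRow I' → ¬ I' (c k j) → j ≢ j₀ →
                       I' (c k j₀)
maximal-contains-row {I'} {k} {j} {j₀} (iI' , maximal-I') ¬I'j j≢j₀ =
  maximal-I' (I' ∪ ｛ c k j₀ ｝) (missesEveryRow-∪ k j₀ j iI' ¬I'j j≢j₀) inj₁ (inj₂ refl)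

graph : (ℕ → ℕ) → Subset E
graph g (c k j) = j ≡ g k
graph g (d _) = ⊥

offGraph : (ℕ → ℕ) → Subset E
offGraph g (c k j) = j ≢ g k
offGraph g (d _) = ⊥

offGraph-missesEveryRow : ∀ g → MissesEveryRow (offGraph g)
offGraph-missesEveryRow g = missesEveryRow (λ _ ()) (λ k → g k , λ j≢g → j≢g refl)

offGraph-maximal : ∀ g → Maximal MissesEveryRow (offGraph g)
offGraph-maximal g = offGraph-missesEveryRow g , saturated
  where
  saturated : ∀ K → MissesEveryRow K → offGraph g ⊆ K → K ⊆ offGraph g
  saturated K iK _ {d i} Kd = avoids-d iK i Kd
  saturated K iK B⊆K {c k j} Kj j≡g with misses iK k
  ... | j₀ , ¬Kj₀ with j₀ ≟ g k
  ... | yes j₀≡g = ¬Kj₀ (subst (λ i → K (c k i)) (trans j≡g (sym j₀≡g)) Kj)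
  ... | no j₀≢g = ¬Kj₀ (B⊆K j₀≢g)

Cells : Subset E
Cells (c _ _) = ⊤
Cells (d _) = ⊥

graph-onePerBlock : ∀ {g} → (∀ {k k'} → g k ≡ g k' → k ≡ k') → OnePerBlock (graph g)
graph-onePerBlock {g} g-injective = onePerBlock u
  where
  u : ∀ x y → graph g x → graph g y → column x ≡ column y → x ≡ y
  u (c k j) (c k' j') j≡gk j'≡gk' e =
    cong₂ c (g-injective (trans (sym j≡gk) (trans e j'≡gk'))) e

cells-split : ∀ g → Cells ≐ (graph g ∪ offGraph g)
cells-split g = split , λ { {c _ _} _ → tt ; {d _} (inj₁ ()) ; {d _} (inj₂ ()) }
  where
  split : Cells ⊆ (graph g ∪ offGraph g)
  split {c k j} _ with j ≟ g k
  ... | yes j≡g = inj₁ j≡g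
  ... | no j≢g = inj₂ j≢g

cells-extendable :
  ∀ {I₁ I₂ J} → OnePerBlock I₁ → MissesEveryRow I₂ → J ≐ (I₁ ∪ I₂) → Cells ⊆ J →
  ∃[ j ] (¬ J (d j) × ∃[ I₁' ] ∃[ I₂' ]
    (OnePerBlock I₁' × MissesEveryRow I₂' × (J ∪ ｛ d j ｝) ≐ (I₁' ∪ I₂')))
cells-extendable {I₁} {I₂} {J} iI₁ iI₂ (J⊆I₁∪I₂ , I₁∪I₂⊆J) cells⊆J =
  hole 0 , hole-column-outside-J 0 ,
  shifted , offGraph (hole ∘ suc) , onePerBlock shifted-unique ,
  offGraph-missesEveryRow (hole ∘ suc) , to , from
  where
  hole : ℕ → ℕ
  hole k = proj₁ (misses iI₂ k)

  hole-in-I₁ : ∀ k → I₁ (c k (hole k))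
  hole-in-I₁ k with J⊆I₁∪I₂ (cells⊆J {c k (hole k)} tt)
  ... | inj₁ I₁-hole = I₁-hole
  ... | inj₂ I₂-hole = ⊥-elim (proj₂ (misses iI₂ k) I₂-hole)

  hole-column-outside-J : ∀ k → ¬ J (d (hole k))
  hole-column-outside-J k J-d with J⊆I₁∪I₂ J-d
  ... | inj₁ I₁-d with unique iI₁ _ _ (hole-in-I₁ k) I₁-d refl
  ...   | ()
  hole-column-outside-J k J-d | inj₂ I₂-d = avoids-d iI₂ _ I₂-d

  hole-injective : ∀ {k k'} → hole k ≡ hole k' → k ≡ k'
  hole-injective e = suc-injective (cong height (unique iI₁ _ _ (hole-in-I₁ _) (hole-in-I₁ _) e))

  shifted : Subset E
  shifted (c k j) = j ≡ hole (suc k)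
  shifted (d j) = J (d j) ⊎ j ≡ hole 0

  d-clear-of-shift : ∀ {i} → shifted (d i) → ∀ k → i ≢ hole (suc k)
  d-clear-of-shift (inj₁ J-d) k refl = hole-column-outside-J (suc k) J-d
  d-clear-of-shift (inj₂ refl) k e = 0≢1+n (hole-injective e)

  shifted-unique : ∀ x y → shifted x → shifted y → column x ≡ column y → x ≡ y
  shifted-unique (d i) (d i') _ _ e = cong d e
  shifted-unique (d i) (c k i') p q e = ⊥-elim (d-clear-of-shift p k (trans e q))
  shifted-unique (c k i) (d i') p q e = ⊥-elim (d-clear-of-shift q k (trans (sym e) p))
  shifted-unique (c k i) (c k' i') p q e =
    cong₂ c (suc-injective (hole-injective (trans (sym p) (trans e q)))) e

  to : J ∪ ｛ d (hole 0) ｝ ⊆ shifted ∪ offGraph (hole ∘ suc)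
  to {c k i} _ with i ≟ hole (suc k)
  ... | yes i≡hole = inj₁ i≡hole
  ... | no i≢hole = inj₂ i≢hole
  to {d i} (inj₁ J-d) = inj₁ (inj₁ J-d)
  to {d i} (inj₂ refl) = inj₁ (inj₂ refl)

  from : shifted ∪ offGraph (hole ∘ suc) ⊆ J ∪ ｛ d (hole 0) ｝
  from {c k i} _ = inj₁ (cells⊆J tt)
  from {d i} (inj₁ (inj₁ J-d)) = inj₁ J-d
  from {d i} (inj₁ (inj₂ refl)) = inj₂ refl

module Classical (em : ∀ {ℓ} → ExcludedMiddle ℓ) where

  missesEveryRow-I3 : ∀ I I' → MissesEveryRow I → Maximal MissesEveryRow I' →
                      ¬ Maximal MissesEveryRow I →
                      ∃[ x ] (x ∈ I' × ¬ (x ∈ I) × MissesEveryRow (I ∪ ｛ x ｝))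
  missesEveryRow-I3 I I' iI maximal-I' = augmentation-from-saturation em iI saturated
    where
    saturated : ¬ (∃[ x ] (x ∈ I' × ¬ (x ∈ I) × MissesEveryRow (I ∪ ｛ x ｝))) →
                ∀ J {y} → MissesEveryRow J → I ⊆ J → J y → ¬ ¬ I y
    saturated _ J {d i} iJ _ J-d _ = avoids-d iJ i J-d
    saturated ¬augmenting J {c k j} iJ I⊆J Jy ¬Iy =
      ¬augmenting (c k j₀ , I'j₀ , ¬Ij₀ ∘ inj₁ , missesEveryRow-∪ k j₀ j iI ¬Iy j≢j₀)
      where
      iI+y : MissesEveryRow (I ∪ ｛ c k j ｝)
      iI+y = missesEveryRow-⊆ _ J iJ λ { (inj₁ Ix) → I⊆J Ix ; (inj₂ refl) → Jy }
      j₀ : ℕ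
      j₀ = proj₁ (misses iI+y k)
      ¬Ij₀ : ¬ (I ∪ ｛ c k j ｝) (c k j₀)
      ¬Ij₀ = proj₂ (misses iI+y k)
      j≢j₀ : j ≢ j₀
      j≢j₀ e = ¬Ij₀ (inj₂ (cong (c k) e))
      ¬I'y : ¬ I' (c k j)
      ¬I'y I'y = ¬augmenting (c k j , I'y , ¬Iy , iI+y)
      I'j₀ : I' (c k j₀)
      I'j₀ = maximal-contains-row maximal-I' ¬I'y j≢j₀

  missesEveryRow-IM : ∀ I X → MissesEveryRow I → I ⊆ X →
                      ∃[ J ] MaximalBetween MissesEveryRow I X J
  missesEveryRow-IM I X iI I⊆X = J , (iJ , I⊆J , J⊆X) , maximal-J
    where
    hole : ℕ → ℕ
    hole k = proj₁ (misses iI k)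
    RowGap : ℕ → Set
    RowGap k = ∃[ j ] ¬ X (c k j)
    J : Subset E
    J (c k j) = X (c k j) × (RowGap k ⊎ j ≢ hole k)
    J (d _) = ⊥
    J⊆X : J ⊆ X
    J⊆X {c k j} = proj₁
    I⊆J : I ⊆ J
    I⊆J {c k j} Ij = I⊆X Ij , inj₂ (λ e → proj₂ (misses iI k) (subst (λ i → I (c k i)) e Ij))
    I⊆J {d i} Id = avoids-d iI i Id
    J-misses : ∀ k → ∃[ j ] ¬ J (c k j)
    J-misses k with em {P = RowGap k}
    ... | yes (j , ¬Xj) = j , ¬Xj ∘ proj₁
    ... | no no-gap = hole k , λ { (_ , inj₁ gap) → no-gap gap ; (_ , inj₂ ne) → ne refl }
    iJ : MissesEveryRow J
    iJ = missesEveryRow (λ _ ()) J-misses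
    maximal-J : ∀ K → MissesEveryRow K → I ⊆ K → K ⊆ X → J ⊆ K → K ⊆ J
    maximal-J K iK _ _ _ {d i} K-d = avoids-d iK i K-d
    maximal-J K iK _ K⊆X J⊆K {c k j} Kj with em {P = RowGap k}
    ... | yes gap = K⊆X Kj , inj₁ gap
    ... | no no-gap = K⊆X Kj , inj₂ j≢hole
      where
      j≢hole : j ≢ hole k
      j≢hole j≡hole with misses iK k
      ... | j₀ , ¬Kj₀ with j₀ ≟ hole k
      ... | yes j₀≡hole = ¬Kj₀ (subst (λ i → K (c k i)) (trans j≡hole (sym j₀≡hole)) Kj)
      ... | no j₀≢hole = ¬Kj₀ (J⊆K (em⇒dne em (λ ¬Xj₀ → no-gap (j₀ , ¬Xj₀)) , inj₂ j₀≢hole))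

  M : Matroid E
  M = partitionMatroid em

  N : Matroid E
  N = record
    { indep = MissesEveryRow
    ; isMatroid = record
      { I1 = missesEveryRow-∅ ; I2 = missesEveryRow-⊆ ; I3 = missesEveryRow-I3 ; IM = missesEveryRow-IM } }

  dual-at-most-one-per-row : ∀ {I} → dualIndep N I → ∀ k {j j'} → I (c k j) → I (c k j') → j ≡ j'
  dual-at-most-one-per-row (B , base-B , I⊆∁B) k {j} {j'} Ij Ij' =
    decidable-stable (j ≟ j') λ j≢j' →
      I⊆∁B Ij (maximal-contains-row base-B (I⊆∁B Ij') (j≢j' ∘ sym))

  N-cofinitary : CoFinitary N
  N-cofinitary I finite-parts = offGraph gap , offGraph-maximal gap , I⊆∁B
    where
    at-most-one : ∀ k {j j'} → I (c k j) → I (c k j') → j ≡ j'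
    at-most-one k Ij Ij' = dual-at-most-one-per-row
      (finite-parts _ (pair-finite _ _) (pair-⊆ {I = I} Ij Ij')) k (inj₁ refl) (inj₂ refl)
    row-gap : ∀ k → ∃[ g ] (∀ {j} → I (c k j) → j ≡ g)
    row-gap k with em {P = ∃[ j ] I (c k j)}
    ... | yes (j₁ , Ij₁) = j₁ , λ Ij → at-most-one k Ij Ij₁
    ... | no empty-row = 0 , λ Ij → ⊥-elim (empty-row (_ , Ij))
    gap : ℕ → ℕ
    gap = proj₁ ∘ row-gap
    I⊆∁B : I ⊆ ∁ (offGraph gap)
    I⊆∁B {c k j} Ij j≢gap = j≢gap (proj₂ (row-gap k) Ij)
    I⊆∁B {d i} _ ()

  cells-independent : unionIndep M N Cells
  cells-independent =
    graph (λ k → k) , offGraph (λ k → k) , graph-onePerBlock (λ e → e) ,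
    offGraph-missesEveryRow (λ k → k) , cells-split (λ k → k)

  union-not-matroid : ¬ IsMatroid (unionIndep M N)
  union-not-matroid isMatroid
    with IsMatroid.IM isMatroid Cells U cells-independent (λ _ → tt)
  ... | J , ((_ , _ , iI₁ , iI₂ , J≐I₁∪I₂) , cells⊆J , _) , maximal-J
    with cells-extendable iI₁ iI₂ J≐I₁∪I₂ cells⊆J
  ... | j , ¬J-d , extension-independent =
    ¬J-d (maximal-J (J ∪ ｛ d j ｝) extension-independent (inj₁ ∘ cells⊆J) (λ _ → tt)
                     inj₁ (inj₂ refl))

claim3p1 : (∀ {ℓ : Level} → ExcludedMiddle ℓ) →
    Σ Set λ E → ∃[ M ] ∃[ N ]
    (Finitary {E} M × CoFinitary {E} N × ¬ IsMatroid (unionIndep M N))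
claim3p1 em = E , M , N , onePerBlock-finitary , N-cofinitary , union-not-matroid
  where open Classical em
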